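{- For all $n\in\mathbb{Z}$, $\gcd(S_n,T_n)=1$, where $(S_n)$ and $(T_n)$ are the sequences described in the context.
   Context: $(S_n)_{n\in\mathbb{Z}}$ is the sequence with $S_{ -2}=S_{ -1}=S_0=S_1=S_2=1$ satisfying $S_{n+5}S_n=S_{n+4}S_{n+1}+S_{n+3}S_{n+2}$ for all $n\in\mathbb{Z}$ (positive integers, $S_{ -n}=S_n$). $(T_n)_{n\in\mathbb{Z}}$ is defined by $T_1=1,T_2=-1,T_3=1,T_4=1,T_5=-7$, $T_{n+5}T_n=T_{n+4}T_{n+1}+T_{n+3}T_{n+2}$ for $n\geq1$, $T_0=0$ and $T_{ -n}=-T_n$ (integers). -}

module Defs where

open import Data.Integer using (ℤ; +_; -_; _+_; _*_; _≤_; 0ℤ; 1ℤ; -1ℤ)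
open import Data.Product using (_×_)
open import Relation.Binary.PropositionalEquality using (_≡_)

Somos5At : (ℤ → ℤ) → ℤ → Set
Somos5At a n =
  a (n + + 5) * a n ≡ a (n + + 4) * a (n + + 1) + a (n + + 3) * a (n + + 2)

IsS : (ℤ → ℤ) → Set
IsS S =
  S (- + 2) ≡ 1ℤ × S -1ℤ ≡ 1ℤ × S 0ℤ ≡ 1ℤ × S 1ℤ ≡ 1ℤ × S (+ 2) ≡ 1ℤ ×
  (∀ n → Somos5At S n)

IsT : (ℤ → ℤ) → Set
IsT T =
  T 1ℤ ≡ 1ℤ × T (+ 2) ≡ -1ℤ × T (+ 3) ≡ 1ℤ × T (+ 4) ≡ 1ℤ × T (+ 5) ≡ - + 7 ×
  (∀ n → 1ℤ ≤ n → Somos5At T n) ×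
  T 0ℤ ≡ 0ℤ ×
  (∀ n → T (- n) ≡ - T n)

-- The two sequences are tied together by three bilinear relations
--   S(n) S(n+3) + T(n+1) T(n+2) = S(n+1) S(n+2),
--   T(n) T(n+3) = S(n+1) S(n+2) + T(n+1) T(n+2),
--   S(n) T(n+4) + S(n+2) T(n+2) + S(n+4) T(n) = 0,
-- which hold at the start and propagate along both recurrences.  Read modulo a common
-- divisor, they show that if S(n), T(n), S(n-1), T(n-1) are pairwise coprime then so are
-- S(n+1), T(n+1), S(n), T(n).  The Somos-5 recurrence is invariant under n ↦ -n, so the
-- positive sequence S, being determined by five consecutive values, is even; as T is odd,
-- negative indices reduce to positive ones.
module Submission where

open import Defs
open import Data.Integer.Base
  using (ℤ; +_; -[1+_]; _+_; _-_; _*_; -_; ∣_∣; 0ℤ; 1ℤ; _≤_; +≤+; ≢-nonZero)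
open import Data.Integer.Coprimality as ℤC using (Coprime; coprime-divisor)
open import Data.Integer.Divisibility.Signed
  using (_∣_; divides; ∣ᵤ⇒∣; ∣⇒∣ᵤ; ∣m+n∣m⇒∣n; ∣m+n∣n⇒∣m; ∣m∣n⇒∣m+n; ∣n⇒∣m*n; ∣m⇒∣m*n)
open import Data.Integer.GCD using (gcd)
import Data.Integer.Properties as ℤP
open import Data.Integer.Tactic.RingSolver using (solve-∀)
open import Data.Nat.Base as ℕ using (ℕ; zero; suc; s≤s; z≤n)
import Data.Nat.Coprimality as ℕC
import Data.Nat.Divisibility as ℕD
import Data.Nat.Properties as ℕP
open import Data.Product using (_×_; _,_; proj₁; proj₂)
open import Data.Sum using (inj₁; inj₂)
open import Function using (_∘_)
open import Relation.Nullary using (contradiction)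
open import Relation.Binary.PropositionalEquality
  using (_≡_; _≢_; refl; sym; trans; cong; cong₂; subst; subst₂; module ≡-Reasoning)

Window₅ : (ℕ → Set) → ℕ → Set
Window₅ P k = P k × P (1 ℕ.+ k) × P (2 ℕ.+ k) × P (3 ℕ.+ k) × P (4 ℕ.+ k)

window-induction : {P : ℕ → Set} →
  (∀ k → Window₅ P k → P (5 ℕ.+ k)) → Window₅ P 0 → ∀ k → P k
window-induction {P} next base = proj₁ ∘ windows
  where
  windows : ∀ k → Window₅ P k
  windows zero    = base
  windows (suc k) with windows k
  ... | w@(_ , p₁ , p₂ , p₃ , p₄) = p₁ , p₂ , p₃ , p₄ , next k w

Somos5 : (ℕ → ℤ) → Set
Somos5 a = ∀ k → a (5 ℕ.+ k) * a k ≡ a (4 ℕ.+ k) * a (1 ℕ.+ k) + a (3 ℕ.+ k) * a (2 ℕ.+ k)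

somos5At-reindex : ∀ {a : ℤ → ℤ} {n i₀ i₁ i₂ i₃ i₄ i₅} →
  n ≡ i₀ → n + + 1 ≡ i₁ → n + + 2 ≡ i₂ → n + + 3 ≡ i₃ → n + + 4 ≡ i₄ → n + + 5 ≡ i₅ →
  Somos5At a n → a i₅ * a i₀ ≡ a i₄ * a i₁ + a i₃ * a i₂
somos5At-reindex refl refl refl refl refl refl rec = rec

somos5-translate : ∀ {a : ℤ → ℤ} c →
  (∀ k → Somos5At a (c + + k)) → Somos5 (λ k → a (c + + k))
somos5-translate {a} c rec k =
  somos5At-reindex {a = a} refl (shift 1) (shift 2) (shift 3) (shift 4) (shift 5) (rec k)
  where
  shift : ∀ i → c + + k + + i ≡ c + + (i ℕ.+ k)
  shift i = lemma c (+ k) (+ i)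
    where lemma : ∀ c x y → c + x + y ≡ c + (y + x)
          lemma = solve-∀

somos5-reflect : ∀ {a : ℤ → ℤ} c →
  (∀ n → Somos5At a n) → Somos5 (λ k → a (c - + k))
somos5-reflect {a} c rec k =
  swap (a (c - + k)) (a (c - + (5 ℕ.+ k))) (a (c - + (1 ℕ.+ k))) (a (c - + (4 ℕ.+ k)))
       (a (c - + (2 ℕ.+ k))) (a (c - + (3 ℕ.+ k)))
       (somos5At-reindex {a = a} refl (shift 1 (4 ℕ.+ k)) (shift 2 (3 ℕ.+ k)) (shift 3 (2 ℕ.+ k))
                                   (shift 4 (1 ℕ.+ k)) (shift 5 k) (rec (c - + (5 ℕ.+ k))))
  where
  shift : ∀ i j → c - + (i ℕ.+ j) + + i ≡ c - + j
  shift i j = lemma c (+ i) (+ j)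
    where lemma : ∀ c x y → c - (x + y) + x ≡ c - y
          lemma = solve-∀
  swap : ∀ x y p q r w → x * y ≡ p * q + r * w → y * x ≡ q * p + w * r
  swap x y p q r w e =
    trans (ℤP.*-comm y x) (trans e (cong₂ _+_ (ℤP.*-comm p q) (ℤP.*-comm r w)))

somos5-unique : ∀ {a b} → Somos5 a → Somos5 b → (∀ k → a k ≢ 0ℤ) →
  Window₅ (λ k → a k ≡ b k) 0 → ∀ k → a k ≡ b k
somos5-unique {a} {b} a-rec b-rec a≢0 = window-induction next
  where
  open ≡-Reasoning
  next : ∀ k → Window₅ (λ k → a k ≡ b k) k → a (5 ℕ.+ k) ≡ b (5 ℕ.+ k)
  next k (e₀ , e₁ , e₂ , e₃ , e₄) =
    ℤP.*-cancelʳ-≡ _ _ (a k) {{≢-nonZero (a≢0 k)}} (begin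
      a (5 ℕ.+ k) * a k                                       ≡⟨ a-rec k ⟩
      a (4 ℕ.+ k) * a (1 ℕ.+ k) + a (3 ℕ.+ k) * a (2 ℕ.+ k)   ≡⟨ cong₂ _+_ (cong₂ _*_ e₄ e₁) (cong₂ _*_ e₃ e₂) ⟩
      b (4 ℕ.+ k) * b (1 ℕ.+ k) + b (3 ℕ.+ k) * b (2 ℕ.+ k)   ≡⟨ b-rec k ⟨
      b (5 ℕ.+ k) * b k                                       ≡⟨ cong (b (5 ℕ.+ k) *_) e₀ ⟨
      b (5 ℕ.+ k) * a k                                       ∎)

somos5-step-≤ : ∀ {x a₀ a₁ a₂ a₃ a₄} → x * a₀ ≡ a₄ * a₁ + a₃ * a₂ →
  1ℤ ≤ a₀ → a₀ ≤ a₁ → 1ℤ ≤ a₂ → 1ℤ ≤ a₃ → 1ℤ ≤ a₄ → a₄ ≤ x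
somos5-step-≤ {x} {a₀@(+ _)} {a₁} {a₂@(+ _)} {a₃@(+ _)} {a₄@(+ _)} rec
  (+≤+ (s≤s _)) a₀≤a₁ (+≤+ (s≤s _)) (+≤+ (s≤s _)) (+≤+ (s≤s _)) =
  ℤP.*-cancelʳ-≤-pos a₄ x a₀ (begin
    a₄ * a₀            ≤⟨ ℤP.*-monoˡ-≤-nonNeg a₄ a₀≤a₁ ⟩
    a₄ * a₁            ≤⟨ ℤP.i≤i+j (a₄ * a₁) (a₃ * a₂) ⟩
    a₄ * a₁ + a₃ * a₂  ≡⟨ rec ⟨
    x * a₀             ∎)
  where open ℤP.≤-Reasoning

somos5-positive-monotone : ∀ {a} → Somos5 a →
  Window₅ (λ k → 1ℤ ≤ a k × a k ≤ a (1 ℕ.+ k)) 0 → ∀ k → 1ℤ ≤ a k × a k ≤ a (1 ℕ.+ k)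
somos5-positive-monotone {a} rec = window-induction next
  where
  next : ∀ k → Window₅ (λ k → 1ℤ ≤ a k × a k ≤ a (1 ℕ.+ k)) k →
         1ℤ ≤ a (5 ℕ.+ k) × a (5 ℕ.+ k) ≤ a (6 ℕ.+ k)
  next k (_ , (1≤a₁ , a₁≤a₂) , _ , (1≤a₃ , _) , (1≤a₄ , a₄≤a₅)) =
    1≤a₅ , somos5-step-≤ (rec (1 ℕ.+ k)) 1≤a₁ a₁≤a₂ 1≤a₃ 1≤a₄ 1≤a₅
    where
    1≤a₅ : 1ℤ ≤ a (5 ℕ.+ k)
    1≤a₅ = ℤP.≤-trans 1≤a₄ a₄≤a₅

nondecreasing⇒≤ : ∀ {a : ℕ → ℤ} → (∀ k → a k ≤ a (1 ℕ.+ k)) → ∀ j k → a j ≤ a (j ℕ.+ k)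
nondecreasing⇒≤ {a} step j zero    = ℤP.≤-reflexive (cong a (sym (ℕP.+-identityʳ j)))
nondecreasing⇒≤ {a} step j (suc k) =
  ℤP.≤-trans (nondecreasing⇒≤ step j k)
             (subst (λ i → a (j ℕ.+ k) ≤ a i) (sym (ℕP.+-suc j k)) (step (j ℕ.+ k)))

∣1⇒coprime : ∀ {a b} → (∀ {d} → d ∣ a → d ∣ b → d ∣ 1ℤ) → Coprime a b
∣1⇒coprime {a} {b} common {d} (d∣a , d∣b) =
  ℕD.∣1⇒≡1 (∣⇒∣ᵤ (common {+ d} (∣ᵤ⇒∣ {i = a} d∣a) (∣ᵤ⇒∣ {i = b} d∣b)))

coprime⇒∣1 : ∀ {a b d} → Coprime a b → d ∣ a → d ∣ b → d ∣ 1ℤ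
coprime⇒∣1 a⊥b d∣a d∣b =
  ∣ᵤ⇒∣ (subst (ℕD._∣ 1) (sym (a⊥b (∣⇒∣ᵤ d∣a , ∣⇒∣ᵤ d∣b))) ℕD.∣-refl)

coprime-∣ˡ : ∀ {a b d} → Coprime a b → d ∣ a → Coprime d b
coprime-∣ˡ a⊥b d∣a (e∣d , e∣b) = a⊥b (ℕD.∣-trans e∣d (∣⇒∣ᵤ d∣a) , e∣b)

coprime-cancel : ∀ {a b c d} → Coprime a b → d ∣ a → d ∣ b * c → d ∣ c
coprime-cancel {a} {b} {c} {d} a⊥b d∣a d∣bc =
  ∣ᵤ⇒∣ (coprime-divisor d b c (coprime-∣ˡ {a} {b} a⊥b d∣a) (∣⇒∣ᵤ d∣bc))

coprime-via : ∀ {a b c} → Coprime a c → (∀ {d} → d ∣ a → d ∣ b → d ∣ c) → Coprime a b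
coprime-via {a} {b} {c} a⊥c reduce =
  ∣1⇒coprime {a} {b} λ d∣a d∣b → coprime⇒∣1 {a} {c} a⊥c d∣a (reduce d∣a d∣b)

coprime-* : ∀ {a b c} → Coprime a b → Coprime a c → Coprime a (b * c)
coprime-* {a} {b} {c} a⊥b a⊥c =
  coprime-via {a} {b * c} {c} a⊥c λ d∣a d∣bc → coprime-cancel {a} {b} {c} a⊥b d∣a d∣bc

coprime-negʳ : ∀ {a b} → Coprime a b → Coprime a (- b)
coprime-negʳ {a} {b} = subst (ℕC.Coprime ∣ a ∣) (sym (ℤP.∣-i∣≡∣i∣ b))

≡1⇒coprime : ∀ {a} b → a ≡ 1ℤ → Coprime a b
≡1⇒coprime b refl = ℕC.1-coprimeTo ∣ b ∣

nonunit-coprime⇒≢0 : ∀ {a b} → ∣ a ∣ ≢ 1 → Coprime a b → b ≢ 0ℤ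
nonunit-coprime⇒≢0 ∣a∣≢1 a⊥b refl = ∣a∣≢1 (ℕC.0-coprimeTo-m⇒m≡1 (ℕC.sym a⊥b))

PairwiseCoprime : ℤ → ℤ → ℤ → ℤ → Set
PairwiseCoprime w x y z =
  Coprime w x × Coprime w y × Coprime w z × Coprime x y × Coprime x z × Coprime y z

pairwiseCoprime-step : ∀ {s₀ t₀ s₁ t₁ s₂ t₂ s₃ t₃ s₄ t₄} →
  s₁ * s₄ + t₂ * t₃ ≡ s₂ * s₃ →
  t₁ * t₄ ≡ s₂ * s₃ + t₂ * t₃ →
  s₀ * t₄ + s₂ * t₂ + s₄ * t₀ ≡ 0ℤ →
  PairwiseCoprime s₃ t₃ s₂ t₂ → PairwiseCoprime s₄ t₄ s₃ t₃
pairwiseCoprime-step {s₀} {t₀} {s₁} {t₁} {s₂} {t₂} {s₃} {t₃} {s₄} {t₄} eA eB eC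
  (s₃⊥t₃ , s₃⊥s₂ , s₃⊥t₂ , t₃⊥s₂ , t₃⊥t₂ , s₂⊥t₂) =
  s₄⊥t₄ , flip s₃ s₄ s₃⊥s₄ , flip t₃ s₄ t₃⊥s₄ , flip s₃ t₄ s₃⊥t₄ , flip t₃ t₄ t₃⊥t₄ , s₃⊥t₃
  where
  flip : ∀ a b → Coprime a b → Coprime b a
  flip a b = ℤC.sym {a} {b}

  s₃⊥t₂t₃ : Coprime s₃ (t₂ * t₃)
  s₃⊥t₂t₃ = coprime-* {s₃} {t₂} {t₃} s₃⊥t₂ s₃⊥t₃
  s₂⊥t₂t₃ : Coprime s₂ (t₂ * t₃)
  s₂⊥t₂t₃ = coprime-* {s₂} {t₂} {t₃} s₂⊥t₂ (flip t₃ s₂ t₃⊥s₂)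
  t₃⊥s₂s₃ : Coprime t₃ (s₂ * s₃)
  t₃⊥s₂s₃ = coprime-* {t₃} {s₂} {s₃} t₃⊥s₂ (flip s₃ t₃ s₃⊥t₃)
  t₂⊥s₂s₃ : Coprime t₂ (s₂ * s₃)
  t₂⊥s₂s₃ = coprime-* {t₂} {s₂} {s₃} (flip s₂ t₂ s₂⊥t₂) (flip s₃ t₂ s₃⊥t₂)

  A-∣ : ∀ {d} → d ∣ s₂ * s₃ → d ∣ s₄ → d ∣ t₂ * t₃
  A-∣ d∣s₂s₃ d∣s₄ = ∣m+n∣m⇒∣n (subst (_ ∣_) (sym eA) d∣s₂s₃) (∣n⇒∣m*n s₁ d∣s₄)
  A-∣′ : ∀ {d} → d ∣ t₂ * t₃ → d ∣ s₄ → d ∣ s₂ * s₃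
  A-∣′ d∣t₂t₃ d∣s₄ = subst (_ ∣_) eA (∣m∣n⇒∣m+n (∣n⇒∣m*n s₁ d∣s₄) d∣t₂t₃)
  B-∣ : ∀ {d} → d ∣ s₂ * s₃ → d ∣ t₄ → d ∣ t₂ * t₃
  B-∣ d∣s₂s₃ d∣t₄ = ∣m+n∣m⇒∣n (subst (_ ∣_) eB (∣n⇒∣m*n t₁ d∣t₄)) d∣s₂s₃
  B-∣′ : ∀ {d} → d ∣ t₂ * t₃ → d ∣ t₄ → d ∣ s₂ * s₃
  B-∣′ d∣t₂t₃ d∣t₄ = ∣m+n∣n⇒∣m (subst (_ ∣_) eB (∣n⇒∣m*n t₁ d∣t₄)) d∣t₂t₃
  C-∣ : ∀ {d} → d ∣ s₄ → d ∣ t₄ → d ∣ s₂ * t₂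
  C-∣ d∣s₄ d∣t₄ =
    ∣m+n∣m⇒∣n (∣m+n∣n⇒∣m (subst (_ ∣_) (sym eC) (divides 0ℤ refl)) (∣m⇒∣m*n t₀ d∣s₄))
              (∣n⇒∣m*n s₀ d∣t₄)

  s₃⊥s₄ : Coprime s₃ s₄
  s₃⊥s₄ = coprime-via {s₃} {s₄} s₃⊥t₂t₃ λ d∣s₃ d∣s₄ → A-∣ (∣n⇒∣m*n s₂ d∣s₃) d∣s₄
  s₂⊥s₄ : Coprime s₂ s₄
  s₂⊥s₄ = coprime-via {s₂} {s₄} s₂⊥t₂t₃ λ d∣s₂ d∣s₄ → A-∣ (∣m⇒∣m*n s₃ d∣s₂) d∣s₄
  t₃⊥s₄ : Coprime t₃ s₄
  t₃⊥s₄ = coprime-via {t₃} {s₄} t₃⊥s₂s₃ λ d∣t₃ d∣s₄ → A-∣′ (∣n⇒∣m*n t₂ d∣t₃) d∣s₄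
  s₃⊥t₄ : Coprime s₃ t₄
  s₃⊥t₄ = coprime-via {s₃} {t₄} s₃⊥t₂t₃ λ d∣s₃ d∣t₄ → B-∣ (∣n⇒∣m*n s₂ d∣s₃) d∣t₄
  t₃⊥t₄ : Coprime t₃ t₄
  t₃⊥t₄ = coprime-via {t₃} {t₄} t₃⊥s₂s₃ λ d∣t₃ d∣t₄ → B-∣′ (∣n⇒∣m*n t₂ d∣t₃) d∣t₄
  t₂⊥t₄ : Coprime t₂ t₄
  t₂⊥t₄ = coprime-via {t₂} {t₄} t₂⊥s₂s₃ λ d∣t₂ d∣t₄ → B-∣′ (∣m⇒∣m*n t₃ d∣t₂) d∣t₄
  s₄⊥t₄ : Coprime s₄ t₄
  s₄⊥t₄ = ∣1⇒coprime {s₄} {t₄} λ d∣s₄ d∣t₄ →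
    coprime⇒∣1 {t₄} {t₂} (flip t₂ t₄ t₂⊥t₄) d∣t₄
      (coprime-cancel {s₄} {s₂} {t₂} (flip s₂ s₄ s₂⊥s₄) d∣s₄ (C-∣ d∣s₄ d∣t₄))

RelA RelB RelC : (ℕ → ℤ) → (ℕ → ℤ) → ℕ → Set
RelA s t n = s n * s (3 ℕ.+ n) + t (1 ℕ.+ n) * t (2 ℕ.+ n) ≡ s (1 ℕ.+ n) * s (2 ℕ.+ n)
RelB s t n = t n * t (3 ℕ.+ n) ≡ s (1 ℕ.+ n) * s (2 ℕ.+ n) + t (1 ℕ.+ n) * t (2 ℕ.+ n)
RelC s t n = s n * t (4 ℕ.+ n) + s (2 ℕ.+ n) * t (2 ℕ.+ n) + s (4 ℕ.+ n) * t n ≡ 0ℤ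

Relations : (ℕ → ℤ) → (ℕ → ℤ) → ℕ → Set
Relations s t n = RelA s t n × RelA s t (1 ℕ.+ n) × RelB s t n × RelB s t (1 ℕ.+ n) × RelC s t n

combination-≡0 : ∀ q₁ q₂ q₃ q₄ q₅ q₆ q₇ {l₁ r₁ l₂ r₂ l₃ r₃ l₄ r₄ l₅ r₅ l₆ r₆ l₇ r₇ : ℤ} →
  l₁ ≡ r₁ → l₂ ≡ r₂ → l₃ ≡ r₃ → l₄ ≡ r₄ → l₅ ≡ r₅ → l₆ ≡ r₆ → l₇ ≡ r₇ →
  q₁ * (l₁ - r₁) + q₂ * (l₂ - r₂) + q₃ * (l₃ - r₃) + q₄ * (l₄ - r₄)
    + q₅ * (l₅ - r₅) + q₆ * (l₆ - r₆) + q₇ * (l₇ - r₇) ≡ 0ℤ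
combination-≡0 q₁ q₂ q₃ q₄ q₅ q₆ q₇ {r₁ = r₁} {r₂ = r₂} {r₃ = r₃} {r₄ = r₄} {r₅ = r₅}
  {r₆ = r₆} {r₇ = r₇} refl refl refl refl refl refl refl =
  lemma q₁ q₂ q₃ q₄ q₅ q₆ q₇ r₁ r₂ r₃ r₄ r₅ r₆ r₇
  where
  lemma : ∀ q₁ q₂ q₃ q₄ q₅ q₆ q₇ r₁ r₂ r₃ r₄ r₅ r₆ r₇ →
    q₁ * (r₁ - r₁) + q₂ * (r₂ - r₂) + q₃ * (r₃ - r₃) + q₄ * (r₄ - r₄)
      + q₅ * (r₅ - r₅) + q₆ * (r₆ - r₆) + q₇ * (r₇ - r₇) ≡ 0ℤ
  lemma = solve-∀

cancel-≢0 : ∀ m {l r} → m ≢ 0ℤ → m * (l - r) ≡ 0ℤ → l ≡ r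
cancel-≢0 m {l} {r} m≢0 e with ℤP.i*j≡0⇒i≡0∨j≡0 m e
... | inj₁ m≡0   = contradiction m≡0 m≢0
... | inj₂ l-r≡0 = ℤP.i-j≡0⇒i≡j l r l-r≡0

-- s(n) A(n+2), t(n) B(n+2) and s(n) t(n) C(n+1) are integer combinations of the defects of
-- A(n), A(n+1), B(n), B(n+1), C(n) and of the two recurrences at n.
certificate-A : ∀ a₀ a₁ a₂ a₃ a₄ a₅ b₀ b₁ b₂ b₃ b₄ b₅ →
  a₀ * (a₂ * a₅ + b₃ * b₄ - a₃ * a₄) ≡
    (- a₄) * (a₀ * a₃ + b₁ * b₂ - a₁ * a₂) + (- a₂) * (a₁ * a₄ + b₂ * b₃ - a₂ * a₃)
  + (- a₄) * (b₀ * b₃ - (a₁ * a₂ + b₁ * b₂)) + 0ℤ * (b₁ * b₄ - (a₂ * a₃ + b₂ * b₃))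
  + b₃ * (a₀ * b₄ + a₂ * b₂ + a₄ * b₀ - 0ℤ)
  + a₂ * (a₅ * a₀ - (a₄ * a₁ + a₃ * a₂)) + 0ℤ * (b₅ * b₀ - (b₄ * b₁ + b₃ * b₂))
certificate-A = solve-∀

certificate-B : ∀ a₀ a₁ a₂ a₃ a₄ a₅ b₀ b₁ b₂ b₃ b₄ b₅ →
  b₀ * (b₂ * b₅ - (a₃ * a₄ + b₃ * b₄)) ≡
    b₄ * (a₀ * a₃ + b₁ * b₂ - a₁ * a₂) + 0ℤ * (a₁ * a₄ + b₂ * b₃ - a₂ * a₃)
  + (- b₄) * (b₀ * b₃ - (a₁ * a₂ + b₁ * b₂)) + (- b₂) * (b₁ * b₄ - (a₂ * a₃ + b₂ * b₃))
  + (- a₃) * (a₀ * b₄ + a₂ * b₂ + a₄ * b₀ - 0ℤ)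
  + 0ℤ * (a₅ * a₀ - (a₄ * a₁ + a₃ * a₂)) + b₂ * (b₅ * b₀ - (b₄ * b₁ + b₃ * b₂))
certificate-B = solve-∀

certificate-C : ∀ a₀ a₁ a₂ a₃ a₄ a₅ b₀ b₁ b₂ b₃ b₄ b₅ →
  (a₀ * b₀) * (a₁ * b₅ + a₃ * b₃ + a₅ * b₁ - 0ℤ) ≡
    (b₀ * b₃ - a₁ * a₂) * (a₀ * a₃ + b₁ * b₂ - a₁ * a₂)
  + (- (b₀ * b₁)) * (a₁ * a₄ + b₂ * b₃ - a₂ * a₃)
  + (a₁ * a₂) * (b₀ * b₃ - (a₁ * a₂ + b₁ * b₂)) + (- (a₀ * a₁)) * (b₁ * b₄ - (a₂ * a₃ + b₂ * b₃))
  + (+ 2 * a₁ * b₁) * (a₀ * b₄ + a₂ * b₂ + a₄ * b₀ - 0ℤ)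
  + (b₀ * b₁) * (a₅ * a₀ - (a₄ * a₁ + a₃ * a₂)) + (a₀ * a₁) * (b₅ * b₀ - (b₄ * b₁ + b₃ * b₂))
certificate-C = solve-∀

relations-step : ∀ {s t} → Somos5 s → Somos5 t → ∀ {n} → s n ≢ 0ℤ → t n ≢ 0ℤ →
  Relations s t n → Relations s t (1 ℕ.+ n)
relations-step {s} {t} s-rec t-rec {n} sₙ≢0 tₙ≢0 (A₀ , A₁ , B₀ , B₁ , C₀) =
  A₁ , A₂ , B₁ , B₂ , C₁
  where
  a₀ a₁ a₂ a₃ a₄ a₅ b₀ b₁ b₂ b₃ b₄ b₅ : ℤ
  a₀ = s n ; a₁ = s (1 ℕ.+ n) ; a₂ = s (2 ℕ.+ n) ; a₃ = s (3 ℕ.+ n) ; a₄ = s (4 ℕ.+ n) ; a₅ = s (5 ℕ.+ n)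
  b₀ = t n ; b₁ = t (1 ℕ.+ n) ; b₂ = t (2 ℕ.+ n) ; b₃ = t (3 ℕ.+ n) ; b₄ = t (4 ℕ.+ n) ; b₅ = t (5 ℕ.+ n)

  A₂ : RelA s t (2 ℕ.+ n)
  A₂ = cancel-≢0 a₀ sₙ≢0 (trans (certificate-A a₀ a₁ a₂ a₃ a₄ a₅ b₀ b₁ b₂ b₃ b₄ b₅)
         (combination-≡0 (- a₄) (- a₂) (- a₄) 0ℤ b₃ a₂ 0ℤ A₀ A₁ B₀ B₁ C₀ (s-rec n) (t-rec n)))
  B₂ : RelB s t (2 ℕ.+ n)
  B₂ = cancel-≢0 b₀ tₙ≢0 (trans (certificate-B a₀ a₁ a₂ a₃ a₄ a₅ b₀ b₁ b₂ b₃ b₄ b₅)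
         (combination-≡0 b₄ 0ℤ (- b₄) (- b₂) (- a₃) 0ℤ b₂ A₀ A₁ B₀ B₁ C₀ (s-rec n) (t-rec n)))
  C₁ : RelC s t (1 ℕ.+ n)
  C₁ = cancel-≢0 (a₀ * b₀) sₙtₙ≢0 (trans (certificate-C a₀ a₁ a₂ a₃ a₄ a₅ b₀ b₁ b₂ b₃ b₄ b₅)
         (combination-≡0 (b₀ * b₃ - a₁ * a₂) (- (b₀ * b₁)) (a₁ * a₂) (- (a₀ * a₁)) (+ 2 * a₁ * b₁)
                         (b₀ * b₁) (a₀ * a₁) A₀ A₁ B₀ B₁ C₀ (s-rec n) (t-rec n)))
    where
    sₙtₙ≢0 : a₀ * b₀ ≢ 0ℤ
    sₙtₙ≢0 e with ℤP.i*j≡0⇒i≡0∨j≡0 a₀ e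
    ... | inj₁ a₀≡0 = sₙ≢0 a₀≡0
    ... | inj₂ b₀≡0 = tₙ≢0 b₀≡0

coprime-propagation : ∀ {s t} → Somos5 s → Somos5 t →
  (∀ k → s k ≢ 0ℤ) → (∀ k → ∣ s (3 ℕ.+ k) ∣ ≢ 1) →
  Relations s t 0 → PairwiseCoprime (s 3) (t 3) (s 2) (t 2) → t 0 ≢ 0ℤ → t 1 ≢ 0ℤ →
  ∀ k → Coprime (s (2 ℕ.+ k)) (t (2 ℕ.+ k))
coprime-propagation {s} {t} s-rec t-rec s≢0 s-nonunit rel₀ pc₀ t₀≢0 t₁≢0 k =
  coprime (invariant k)
  where
  -- t(w+2) ≢ 0 since it is coprime to the non-unit s(w+3); it is needed to cancel by t later.
  Invariant : ℕ → Set
  Invariant w = Relations s t w × PairwiseCoprime (s (3 ℕ.+ w)) (t (3 ℕ.+ w)) (s (2 ℕ.+ w)) (t (2 ℕ.+ w))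
              × t w ≢ 0ℤ × t (1 ℕ.+ w) ≢ 0ℤ

  invariant : ∀ w → Invariant w
  invariant zero = rel₀ , pc₀ , t₀≢0 , t₁≢0
  invariant (suc w) with invariant w
  ... | rel@(_ , A₁ , _ , B₁ , C₀) , pc@(_ , _ , s₃⊥t₂ , _) , tw≢0 , tw+1≢0 =
    relations-step {s} {t} s-rec t-rec (s≢0 w) tw≢0 rel ,
    pairwiseCoprime-step {s w} {t w} {s (1 ℕ.+ w)} {t (1 ℕ.+ w)} {s (2 ℕ.+ w)} {t (2 ℕ.+ w)}
                         {s (3 ℕ.+ w)} {t (3 ℕ.+ w)} {s (4 ℕ.+ w)} {t (4 ℕ.+ w)} A₁ B₁ C₀ pc ,
    tw+1≢0 ,
    nonunit-coprime⇒≢0 {s (3 ℕ.+ w)} (s-nonunit w) s₃⊥t₂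

  coprime : ∀ {w} → Invariant w → Coprime (s (2 ℕ.+ w)) (t (2 ℕ.+ w))
  coprime (_ , (_ , _ , _ , _ , _ , s₂⊥t₂) , _) = s₂⊥t₂

somos5-value : ∀ {a} → Somos5 a → ∀ k {x₁ x₂ x₃ x₄} → a k ≡ 1ℤ →
  a (1 ℕ.+ k) ≡ x₁ → a (2 ℕ.+ k) ≡ x₂ → a (3 ℕ.+ k) ≡ x₃ → a (4 ℕ.+ k) ≡ x₄ →
  a (5 ℕ.+ k) ≡ x₄ * x₁ + x₃ * x₂
somos5-value {a} rec k aₖ≡1 refl refl refl refl = begin
  a (5 ℕ.+ k)          ≡⟨ ℤP.*-identityʳ (a (5 ℕ.+ k)) ⟨
  a (5 ℕ.+ k) * 1ℤ     ≡⟨ cong (a (5 ℕ.+ k) *_) aₖ≡1 ⟨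
  a (5 ℕ.+ k) * a k    ≡⟨ rec k ⟩
  a (4 ℕ.+ k) * a (1 ℕ.+ k) + a (3 ℕ.+ k) * a (2 ℕ.+ k) ∎
  where open ≡-Reasoning

1≤⇒≢0 : ∀ {x} → 1ℤ ≤ x → x ≢ 0ℤ
1≤⇒≢0 (+≤+ (s≤s _)) ()

2≤⇒nonunit : ∀ {x} → + 2 ≤ x → ∣ x ∣ ≢ 1
2≤⇒nonunit (+≤+ (s≤s (s≤s _))) ()

module SomosPair (S T : ℤ → ℤ) (hS : IsS S) (hT : IsT T) where

  S-rec : ∀ n → Somos5At S n
  S-rec = let (_ , _ , _ , _ , _ , rec) = hS in rec

  -- u k = S(k-2), v k = S(2-k), s k = S(k+1), t k = T(k+1); s k is definitionally u (3 + k).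
  u v s t : ℕ → ℤ
  u k = S (- + 2 + + k)
  v k = S (+ 2 - + k)
  s k = S (1ℤ + + k)
  t k = T (1ℤ + + k)

  u-rec : Somos5 u
  u-rec = somos5-translate {S} (- + 2) (λ k → S-rec _)

  v-rec : Somos5 v
  v-rec = somos5-reflect {S} (+ 2) S-rec

  s-rec : Somos5 s
  s-rec = somos5-translate {S} 1ℤ (λ k → S-rec _)

  t-rec : Somos5 t
  t-rec = let (_ , _ , _ , _ , _ , rec , _) = hT in
    somos5-translate {T} 1ℤ (λ k → rec (1ℤ + + k) (+≤+ (s≤s z≤n)))

  u₀ : u 0 ≡ 1ℤ
  u₀ = let (e , _) = hS in e
  u₁ : u 1 ≡ 1ℤ
  u₁ = let (_ , e , _) = hS in e
  u₂ : u 2 ≡ 1ℤ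
  u₂ = let (_ , _ , e , _) = hS in e
  u₃ : u 3 ≡ 1ℤ
  u₃ = let (_ , _ , _ , e , _) = hS in e
  u₄ : u 4 ≡ 1ℤ
  u₄ = let (_ , _ , _ , _ , e , _) = hS in e
  u₅ : u 5 ≡ + 2
  u₅ = somos5-value {u} u-rec 0 u₀ u₁ u₂ u₃ u₄
  u₆ : u 6 ≡ + 3
  u₆ = somos5-value {u} u-rec 1 u₁ u₂ u₃ u₄ u₅
  u₇ : u 7 ≡ + 5
  u₇ = somos5-value {u} u-rec 2 u₂ u₃ u₄ u₅ u₆

  s₀ : s 0 ≡ 1ℤ
  s₀ = u₃
  s₁ : s 1 ≡ 1ℤ
  s₁ = u₄
  s₂ : s 2 ≡ + 2
  s₂ = u₅
  s₃ : s 3 ≡ + 3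
  s₃ = u₆
  s₄ : s 4 ≡ + 5
  s₄ = u₇

  t₀ : t 0 ≡ 1ℤ
  t₀ = let (e , _) = hT in e
  t₁ : t 1 ≡ - 1ℤ
  t₁ = let (_ , e , _) = hT in e
  t₂ : t 2 ≡ 1ℤ
  t₂ = let (_ , _ , e , _) = hT in e
  t₃ : t 3 ≡ 1ℤ
  t₃ = let (_ , _ , _ , e , _) = hT in e
  t₄ : t 4 ≡ - + 7
  t₄ = let (_ , _ , _ , _ , e , _) = hT in e

  relations₀ : Relations s t 0
  relations₀ = A₀ , A₁ , B₀ , B₁ , C₀
    where
    A₀ : RelA s t 0
    A₀ rewrite s₀ | s₁ | s₂ | s₃ | t₁ | t₂ = refl
    A₁ : RelA s t 1
    A₁ rewrite s₁ | s₂ | s₃ | s₄ | t₂ | t₃ = refl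
    B₀ : RelB s t 0
    B₀ rewrite s₁ | s₂ | t₀ | t₁ | t₂ | t₃ = refl
    B₁ : RelB s t 1
    B₁ rewrite s₂ | s₃ | t₁ | t₂ | t₃ | t₄ = refl
    C₀ : RelC s t 0
    C₀ rewrite s₀ | s₂ | s₄ | t₀ | t₂ | t₄ = refl

  pairwiseCoprime₀ : PairwiseCoprime (s 3) (t 3) (s 2) (t 2)
  pairwiseCoprime₀ rewrite s₃ | t₃ | s₂ | t₂ =
    ℕC.gcd≡1⇒coprime refl , ℕC.gcd≡1⇒coprime refl , ℕC.gcd≡1⇒coprime refl ,
    ℕC.gcd≡1⇒coprime refl , ℕC.gcd≡1⇒coprime refl , ℕC.gcd≡1⇒coprime refl

  u-rising : ∀ k → 1ℤ ≤ u k × u k ≤ u (1 ℕ.+ k)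
  u-rising = somos5-positive-monotone {u} u-rec
    ( (≤-from-values refl u₀ ℕP.≤-refl , ≤-from-values u₀ u₁ ℕP.≤-refl)
    , (≤-from-values refl u₁ ℕP.≤-refl , ≤-from-values u₁ u₂ ℕP.≤-refl)
    , (≤-from-values refl u₂ ℕP.≤-refl , ≤-from-values u₂ u₃ ℕP.≤-refl)
    , (≤-from-values refl u₃ ℕP.≤-refl , ≤-from-values u₃ u₄ ℕP.≤-refl)
    , (≤-from-values refl u₄ ℕP.≤-refl , ≤-from-values u₄ u₅ (s≤s z≤n)))
    where
    ≤-from-values : ∀ {x y m n} → x ≡ + m → y ≡ + n → m ℕ.≤ n → x ≤ y
    ≤-from-values refl refl = +≤+

  s≢0 : ∀ k → s k ≢ 0ℤ
  s≢0 k = 1≤⇒≢0 (proj₁ (u-rising (3 ℕ.+ k)))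

  s-nonunit : ∀ k → ∣ s (3 ℕ.+ k) ∣ ≢ 1
  s-nonunit k =
    2≤⇒nonunit (subst (_≤ u (5 ℕ.+ suc k)) u₅ (nondecreasing⇒≤ (proj₂ ∘ u-rising) 5 (suc k)))

  S-even : ∀ k → S -[1+ k ] ≡ S (+ suc k)
  S-even k = sym (somos5-unique {u} {v} u-rec v-rec (1≤⇒≢0 ∘ proj₁ ∘ u-rising)
    (trans u₀ (sym u₄) , trans u₁ (sym u₃) , refl , trans u₃ (sym u₁) , trans u₄ (sym u₀)) (3 ℕ.+ k))

  coprime-nonneg : ∀ k → Coprime (S (+ k)) (T (+ k))
  coprime-nonneg 0 = ≡1⇒coprime (T 0ℤ) u₂
  coprime-nonneg 1 = ≡1⇒coprime (T 1ℤ) u₃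
  coprime-nonneg 2 = ≡1⇒coprime (T (+ 2)) u₄
  coprime-nonneg (suc (suc (suc k))) =
    coprime-propagation {s} {t} s-rec t-rec s≢0 s-nonunit relations₀ pairwiseCoprime₀
      (subst (_≢ 0ℤ) (sym t₀) λ ()) (subst (_≢ 0ℤ) (sym t₁) λ ()) k

  coprime : ∀ n → Coprime (S n) (T n)
  coprime (+ k)    = coprime-nonneg k
  coprime -[1+ k ] = subst₂ Coprime (sym (S-even k)) (sym (T-odd (+ suc k)))
    (coprime-negʳ {S (+ suc k)} {T (+ suc k)} (coprime-nonneg (suc k)))
    where
    T-odd : ∀ n → T (- n) ≡ - T n
    T-odd = let (_ , _ , _ , _ , _ , _ , _ , odd) = hT in odd

lemma3p10 : (S T : ℤ → ℤ) → IsS S → IsT T → ∀ n → gcd (S n) (T n) ≡ 1ℤ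
lemma3p10 S T hS hT n = cong +_ (ℕC.coprime⇒gcd≡1 (coprime n))
  where open SomosPair S T hS hT
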